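{- Let $n$ and $m$ be integers with $n\geq3$ and $m\geq3$. Then (1) $spvc(K_n\times K_m)=pvc_2(K_n\times K_m)=1$; (2) $spvc(K_2\times K_m)=pvc_2(K_2\times K_m)=2$.
   Context: All graphs are simple, finite and undirected; $K_n$ is the complete graph on $n$ vertices. The direct product $G\times H$ has vertex set $V(G)\times V(H)$, with $(g,h)$ adjacent to $(g',h')$ iff $gg'\in E(G)$ and $hh'\in E(H)$. A set of paths between two vertices is called disjoint if they are internally vertex-disjoint. In a vertex-colored graph, a path is vertex-proper if any two adjacent internal vertices of the path receive different colors. A vertex-colored graph is proper vertex $2$-connected if any two vertices are joined by $2$ disjoint vertex-proper paths; for a $2$-connected graph $G$, $pvc_2(G)$ is the smallest number of colors ($\ge1$) in a vertex-coloring making $G$ proper vertex $2$-connected. A $u$-$v$ geodesic is a $u$-$v$ path of length $d(u,v)$; $spvc(G)$ is the smallest number of colors in a vertex-coloring of connected $G$ such that any two vertices $u,v$ are joined by a vertex-proper $u$-$v$ geodesic, with $spvc(G)=0$ for complete $G$. -}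

module Defs where

open import Level using (0ℓ)
open import Data.Nat using (ℕ; zero; suc; _≤_; _<_)
open import Data.Fin using (Fin)
open import Data.Product using (Σ; _×_; _,_; ∃; ∃-syntax)
open import Data.Sum using (_⊎_)
open import Data.List using (List; []; _∷_)
open import Data.List.Membership.Propositional using (_∈_; _∉_)
open import Data.List.Relation.Unary.Unique.Propositional using (Unique)
open import Data.List.Relation.Unary.Linked using (Linked)
open import Relation.Binary.PropositionalEquality using (_≡_; _≢_)
open import Relation.Nullary using (¬_)

record Graph : Set₁ where
  field
    V   : Set
    _~_ : V → V → Set
open Graph public

K : ℕ → Graph
K n = record { V = Fin n ; _~_ = λ i j → i ≢ j }

_×ᵍ_ : Graph → Graph → Graph
G ×ᵍ H = record
  { V   = V G × V H
  ; _~_ = λ { (g , h) (g' , h') → _~_ G g g' × _~_ H h h' } }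

IsComplete : Graph → Set
IsComplete G = ∀ (u v : V G) → u ≢ v → _~_ G u v

module _ (G : Graph) where
  private
    W = V G
    _≈_ = _~_ G

  data Walk : W → W → Set where
    [_]    : (u : W) → Walk u u
    _∷⟨_⟩_ : ∀ {w v} (u : W) → u ≈ w → Walk w v → Walk u v

  vertices : ∀ {u v} → Walk u v → List W
  vertices [ u ]          = u ∷ []
  vertices (u ∷⟨ _ ⟩ p)   = u ∷ vertices p

  len : ∀ {u v} → Walk u v → ℕ
  len [ u ]        = zero
  len (u ∷⟨ _ ⟩ p) = suc (len p)

  initVerts : ∀ {u v} → Walk u v → List W
  initVerts [ u ]        = []
  initVerts (u ∷⟨ _ ⟩ p) = u ∷ initVerts p

  interior : ∀ {u v} → Walk u v → List W
  interior [ u ]        = []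
  interior (u ∷⟨ _ ⟩ p) = initVerts p

  IsPath : ∀ {u v} → Walk u v → Set
  IsPath p = Unique (vertices p)

  VertexProper : ∀ {k} (c : W → Fin k) {u v} → Walk u v → Set
  VertexProper c p = Linked (λ a b → c a ≢ c b) (interior p)

  Disjoint : ∀ {u v} → Walk u v → Walk u v → Set
  Disjoint p q = ∀ x → x ∈ interior p → x ∉ interior q

  IsGeodesic : ∀ {u v} → Walk u v → Set
  IsGeodesic {u} {v} p = IsPath p × (∀ (q : Walk u v) → IsPath q → len p ≤ len q)

  Proper2Connecting : ∀ {k} → (W → Fin k) → Set
  Proper2Connecting c = ∀ (u v : W) → u ≢ v →
    Σ (Walk u v) λ p → Σ (Walk u v) λ q →
      IsPath p × IsPath q × vertices p ≢ vertices q × Disjoint p q ×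
      VertexProper c p × VertexProper c q

  StrongProperConnecting : ∀ {k} → (W → Fin k) → Set
  StrongProperConnecting c = ∀ (u v : W) → u ≢ v →
    Σ (Walk u v) λ p → IsGeodesic p × VertexProper c p

  PVC2≡ : ℕ → Set
  PVC2≡ k = 1 ≤ k × (Σ (W → Fin k) Proper2Connecting)
          × (∀ j → 1 ≤ j → j < k → ¬ Σ (W → Fin j) Proper2Connecting)

  SPVC≡ : ℕ → Set
  SPVC≡ k = (IsComplete G × k ≡ 0)
          ⊎ (¬ IsComplete G × (Σ (W → Fin k) StrongProperConnecting)
             × (∀ j → j < k → ¬ Σ (W → Fin j) StrongProperConnecting))

-- In K n × K m with n, m ≥ 3 any two vertices have a common neighbour (avoid both
-- of their rows and both of their columns), so every pair is joined by a geodesic of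
-- length at most 2 and, using the edge or a second common neighbour, by two disjoint
-- paths with at most one interior vertex each; such paths are vertex-proper under any
-- colouring, so one colour suffices.  K 2 × K m is bipartite with the rows as sides,
-- so colouring a vertex by its row makes every walk vertex-proper.  One colour is not
-- enough there: (0 , b) and (1 , b) have no common neighbour, so every path between
-- them has two adjacent interior vertices.

module Submission where

open import Defs
open import Data.Nat using (ℕ; zero; suc; _+_; _≤_; _<_; z≤n; s≤s)
open import Data.Fin using (Fin; zero; suc)
open import Data.Fin.Properties using (_≟_; ¬Fin0)
open import Data.List.Relation.Unary.All using (All; []; _∷_; lookup)
open import Data.List.Relation.Unary.AllPairs using ([]; _∷_)
open import Data.List.Relation.Unary.Linked using (Linked; []; [-]; _∷_)
open import Data.Product using (Σ; ∃-syntax; _×_; _,_; proj₁; proj₂)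
open import Data.Product.Properties using (,-injectiveˡ; ,-injectiveʳ)
open import Data.Sum using (inj₂)
open import Function using (_∘_)
open import Relation.Nullary using (¬_; Dec; yes; no; contradiction)
open import Relation.Nullary.Decidable using (¬?; _×-dec_)
open import Relation.Binary.PropositionalEquality using (_≡_; _≢_; refl; cong; ≢-sym)

Loopless : Graph → Set
Loopless G = ∀ {u v} → _~_ G u v → u ≢ v

module _ (G : Graph) where
  private
    _⌢_ = _~_ G

  ProperGeodesic : ∀ {k} → (V G → Fin k) → V G → V G → Set
  ProperGeodesic c u v = Σ (Walk G u v) λ p → IsGeodesic G p × VertexProper G c p

  TwoProperPaths : ∀ {k} → (V G → Fin k) → V G → V G → Set
  TwoProperPaths c u v = Σ (Walk G u v) λ p → Σ (Walk G u v) λ q →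
    IsPath G p × IsPath G q × vertices G p ≢ vertices G q × Disjoint G p q ×
    VertexProper G c p × VertexProper G c q

  Far : V G → V G → Set
  Far u v = (q : Walk G u v) → 3 ≤ len G q

  len≥1 : ∀ {u v} → u ≢ v → (q : Walk G u v) → 1 ≤ len G q
  len≥1 u≢v [ _ ]        = contradiction refl u≢v
  len≥1 u≢v (_ ∷⟨ _ ⟩ _) = s≤s z≤n

  len≥2 : ∀ {u v} → u ≢ v → ¬ u ⌢ v → (q : Walk G u v) → 2 ≤ len G q
  len≥2 u≢v u≁v [ _ ]                    = contradiction refl u≢v
  len≥2 u≢v u≁v (_ ∷⟨ u⌢v ⟩ [ _ ])       = contradiction u⌢v u≁v
  len≥2 u≢v u≁v (_ ∷⟨ _ ⟩ (_ ∷⟨ _ ⟩ _))  = s≤s (s≤s z≤n)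

  noCommonNeighbour⇒far : ∀ {u v} → u ≢ v → ¬ u ⌢ v →
    (∀ w → u ⌢ w → ¬ w ⌢ v) → Far u v
  noCommonNeighbour⇒far u≢v u≁v none [ _ ]                         = contradiction refl u≢v
  noCommonNeighbour⇒far u≢v u≁v none (_ ∷⟨ u⌢v ⟩ [ _ ])            = contradiction u⌢v u≁v
  noCommonNeighbour⇒far u≢v u≁v none (_ ∷⟨ u⌢w ⟩ (w ∷⟨ w⌢v ⟩ [ _ ])) = contradiction w⌢v (none w u⌢w)
  noCommonNeighbour⇒far u≢v u≁v none (_ ∷⟨ _ ⟩ (_ ∷⟨ _ ⟩ (_ ∷⟨ _ ⟩ _))) = s≤s (s≤s (s≤s z≤n))

  far⇒≢ : ∀ {u v} → Far u v → u ≢ v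
  far⇒≢ far refl with far [ _ ]
  ... | ()

  monochromatic⇒¬vertexProper : ∀ {u v} (c : V G → Fin 1) (p : Walk G u v) →
    3 ≤ len G p → ¬ VertexProper G c p
  monochromatic⇒¬vertexProper c (_ ∷⟨ _ ⟩ [ _ ])             (s≤s ())
  monochromatic⇒¬vertexProper c (_ ∷⟨ _ ⟩ (_ ∷⟨ _ ⟩ [ _ ])) (s≤s (s≤s ()))
  monochromatic⇒¬vertexProper c (_ ∷⟨ _ ⟩ (_ ∷⟨ _ ⟩ (_ ∷⟨ _ ⟩ _))) _ (c₁≢c₂ ∷ _) =
    c₁≢c₂ (single _ _)
    where
    single : (a b : Fin 1) → a ≡ b
    single zero zero = refl

  properColouring⇒vertexProper : ∀ {k} (c : V G → Fin k) →
    (∀ {u v} → u ⌢ v → c u ≢ c v) → ∀ {u v} (p : Walk G u v) → VertexProper G c p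
  properColouring⇒vertexProper c proper [ _ ]        = []
  properColouring⇒vertexProper c proper (_ ∷⟨ _ ⟩ p) = linked p
    where
    linked : ∀ {u v} (p : Walk G u v) → Linked (λ a b → c a ≢ c b) (initVerts G p)
    linked [ _ ]                        = []
    linked (_ ∷⟨ _ ⟩ [ _ ])             = [-]
    linked (_ ∷⟨ u⌢w ⟩ p@(_ ∷⟨ _ ⟩ _)) = proper u⌢w ∷ linked p

  All≢⇒disjoint : ∀ {u v} (p q : Walk G u v) →
    All (λ x → All (x ≢_) (interior G q)) (interior G p) → Disjoint G p q
  All≢⇒disjoint p q apart x x∈p x∈q = lookup (lookup apart x∈p) x∈q refl

  module _ (loopless : Loopless G) {k} (c : V G → Fin k) where

    edge⇒properGeodesic : ∀ {u v} → u ⌢ v → ProperGeodesic c u v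
    edge⇒properGeodesic {u} {v} u⌢v =
      (u ∷⟨ u⌢v ⟩ [ v ]) , ((u≢v ∷ []) ∷ [] ∷ [] , λ q _ → len≥1 u≢v q) , []
      where u≢v = loopless u⌢v

    commonNeighbour⇒properGeodesic : ∀ {u v w} → u ≢ v → ¬ u ⌢ v → u ⌢ w → w ⌢ v →
      ProperGeodesic c u v
    commonNeighbour⇒properGeodesic {u} {v} {w} u≢v u≁v u⌢w w⌢v =
      (u ∷⟨ u⌢w ⟩ (w ∷⟨ w⌢v ⟩ [ v ])) ,
      ((loopless u⌢w ∷ u≢v ∷ []) ∷ (loopless w⌢v ∷ []) ∷ [] ∷ [] , λ q _ → len≥2 u≢v u≁v q) ,
      [-]

    edgeAndCommonNeighbour⇒twoProperPaths : ∀ {u v w} → u ⌢ v → u ⌢ w → w ⌢ v →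
      TwoProperPaths c u v
    edgeAndCommonNeighbour⇒twoProperPaths {u} {v} {w} u⌢v u⌢w w⌢v =
      (u ∷⟨ u⌢v ⟩ [ v ]) , (u ∷⟨ u⌢w ⟩ (w ∷⟨ w⌢v ⟩ [ v ])) ,
      (loopless u⌢v ∷ []) ∷ [] ∷ [] ,
      (loopless u⌢w ∷ loopless u⌢v ∷ []) ∷ (loopless w⌢v ∷ []) ∷ [] ∷ [] ,
      (λ ()) , (λ _ ()) , [] , [-]

    twoCommonNeighbours⇒twoProperPaths : ∀ {u v w₁ w₂} → u ≢ v → w₁ ≢ w₂ →
      u ⌢ w₁ → w₁ ⌢ v → u ⌢ w₂ → w₂ ⌢ v → TwoProperPaths c u v
    twoCommonNeighbours⇒twoProperPaths {u} {v} {w₁} {w₂} u≢v w₁≢w₂ u⌢w₁ w₁⌢v u⌢w₂ w₂⌢v =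
      p , q ,
      (loopless u⌢w₁ ∷ u≢v ∷ []) ∷ (loopless w₁⌢v ∷ []) ∷ [] ∷ [] ,
      (loopless u⌢w₂ ∷ u≢v ∷ []) ∷ (loopless w₂⌢v ∷ []) ∷ [] ∷ [] ,
      (λ { refl → w₁≢w₂ refl }) , All≢⇒disjoint p q ((w₁≢w₂ ∷ []) ∷ []) , [-] , [-]
      where
      p q : Walk G u v
      p = u ∷⟨ u⌢w₁ ⟩ (w₁ ∷⟨ w₁⌢v ⟩ [ v ])
      q = u ∷⟨ u⌢w₂ ⟩ (w₂ ∷⟨ w₂⌢v ⟩ [ v ])

  far⇒¬monochromaticStrongProper : ∀ {u v} → Far u v →
    ¬ Σ (V G → Fin 1) (StrongProperConnecting G)
  far⇒¬monochromaticStrongProper {u} {v} far (c , spc) =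
    let p , _ , proper = spc u v (far⇒≢ far) in
    monochromatic⇒¬vertexProper c p (far p) proper

  far⇒¬monochromaticProper2 : ∀ {u v} → Far u v →
    ¬ Σ (V G → Fin 1) (Proper2Connecting G)
  far⇒¬monochromaticProper2 {u} {v} far (c , p2c) =
    let p , _ , _ , _ , _ , _ , proper , _ = p2c u v (far⇒≢ far) in
    monochromatic⇒¬vertexProper c p (far p) proper

  spvc≡1 : V G → ¬ IsComplete G → Σ (V G → Fin 1) (StrongProperConnecting G) → SPVC≡ G 1
  spvc≡1 w incomplete colouring = inj₂ (incomplete , colouring , fewer)
    where
    fewer : ∀ j → j < 1 → ¬ Σ (V G → Fin j) (StrongProperConnecting G)
    fewer zero    _         (c , _) = ¬Fin0 (c w)
    fewer (suc _) (s≤s ()) _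

  spvc≡2 : ∀ {u v} → Far u v → ¬ IsComplete G →
    Σ (V G → Fin 2) (StrongProperConnecting G) → SPVC≡ G 2
  spvc≡2 {u} far incomplete colouring = inj₂ (incomplete , colouring , fewer)
    where
    fewer : ∀ j → j < 2 → ¬ Σ (V G → Fin j) (StrongProperConnecting G)
    fewer zero          _               (c , _) = ¬Fin0 (c u)
    fewer (suc zero)    _               = far⇒¬monochromaticStrongProper far
    fewer (suc (suc _)) (s≤s (s≤s ())) _

  pvc₂≡1 : Σ (V G → Fin 1) (Proper2Connecting G) → PVC2≡ G 1
  pvc₂≡1 colouring = s≤s z≤n , colouring , fewer
    where
    fewer : ∀ j → 1 ≤ j → j < 1 → ¬ Σ (V G → Fin j) (Proper2Connecting G)
    fewer (suc _) _ (s≤s ())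

  pvc₂≡2 : ∀ {u v} → Far u v → Σ (V G → Fin 2) (Proper2Connecting G) → PVC2≡ G 2
  pvc₂≡2 far colouring = s≤s z≤n , colouring , fewer
    where
    fewer : ∀ j → 1 ≤ j → j < 2 → ¬ Σ (V G → Fin j) (Proper2Connecting G)
    fewer (suc zero)    _ _               = far⇒¬monochromaticProper2 far
    fewer (suc (suc _)) _ (s≤s (s≤s ()))

≢-fst : ∀ {A B : Set} {a a' : A} {b b' : B} → a ≢ a' → (a , b) ≢ (a' , b')
≢-fst a≢a' = a≢a' ∘ ,-injectiveˡ

≢-snd : ∀ {A B : Set} {a a' : A} {b b' : B} → b ≢ b' → (a , b) ≢ (a' , b')
≢-snd b≢b' = b≢b' ∘ ,-injectiveʳ

another : ∀ {k} (i : Fin (suc (suc k))) → ∃[ j ] i ≢ j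
another zero    = suc zero , λ ()
another (suc _) = zero , λ ()

avoid₂ : ∀ {k} (a b : Fin (3 + k)) → ∃[ x ] x ≢ a × x ≢ b
avoid₂ a b with a ≟ zero | b ≟ zero
... | no a≢0 | no b≢0 = zero , ≢-sym a≢0 , ≢-sym b≢0
... | yes refl | _ with b ≟ suc zero
...   | no b≢1   = suc zero , (λ ()) , ≢-sym b≢1
...   | yes refl = suc (suc zero) , (λ ()) , (λ ())
avoid₂ a b | no _ | yes refl with a ≟ suc zero
...   | no a≢1   = suc zero , ≢-sym a≢1 , (λ ())
...   | yes refl = suc (suc zero) , (λ ()) , (λ ())

Fin2-≢⇒≡ : ∀ {i j x : Fin 2} → i ≢ j → x ≢ i → x ≡ j
Fin2-≢⇒≡ {zero}     {zero}                i≢j _   = contradiction refl i≢j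
Fin2-≢⇒≡ {suc zero} {suc zero}            i≢j _   = contradiction refl i≢j
Fin2-≢⇒≡ {zero}     {suc zero} {zero}     _   x≢i = contradiction refl x≢i
Fin2-≢⇒≡ {zero}     {suc zero} {suc zero} _   _   = refl
Fin2-≢⇒≡ {suc zero} {zero}     {zero}     _   _   = refl
Fin2-≢⇒≡ {suc zero} {zero}     {suc zero} _   x≢i = contradiction refl x≢i

module _ {n m : ℕ} where
  private
    _⌢_ = _~_ (K n ×ᵍ K m)

  K×K-loopless : Loopless (K n ×ᵍ K m)
  K×K-loopless (a≢a , _) refl = a≢a refl

  _⌢?_ : (u v : Fin n × Fin m) → Dec (u ⌢ v)
  (a , b) ⌢? (a' , b') = ¬? (a ≟ a') ×-dec ¬? (b ≟ b')

  K×K-incomplete : Fin n → (b b' : Fin m) → b ≢ b' → ¬ IsComplete (K n ×ᵍ K m)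
  K×K-incomplete a b b' b≢b' complete = proj₁ (complete (a , b) (a , b') (≢-snd b≢b')) refl

module _ {n m : ℕ} {k : ℕ} (c : Fin (3 + n) × Fin (3 + m) → Fin k) where
  private
    G = K (3 + n) ×ᵍ K (3 + m)
    _⌢_ = _~_ G

  commonNeighbour : ∀ u v → ∃[ w ] u ⌢ w × w ⌢ v
  commonNeighbour (a , b) (a' , b') =
    let x , x≢a , x≢a' = avoid₂ a a'
        y , y≢b , y≢b' = avoid₂ b b'
    in (x , y) , (≢-sym x≢a , ≢-sym y≢b) , (x≢a' , y≢b')

  nonadjacent⇒twoProperPaths : ∀ {u v} → u ≢ v → ¬ u ⌢ v → TwoProperPaths G c u v
  nonadjacent⇒twoProperPaths {a , b} {a' , b'} u≢v u≁v with a ≟ a' | b ≟ b'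
  ... | no a≢a' | no b≢b' = contradiction (a≢a' , b≢b') u≁v
  ... | yes refl | _ =
    let x , x≢a , _ = avoid₂ a a
        y , y≢b , y≢b' = avoid₂ b b'
        x' , x'≢a , x'≢x = avoid₂ a x
    in twoCommonNeighbours⇒twoProperPaths G K×K-loopless c u≢v (≢-fst (≢-sym x'≢x))
         (≢-sym x≢a , ≢-sym y≢b) (x≢a , y≢b') (≢-sym x'≢a , ≢-sym y≢b) (x'≢a , y≢b')
  ... | no a≢a' | yes refl =
    let x , x≢a , x≢a' = avoid₂ a a'
        y , y≢b , _ = avoid₂ b b
        y' , y'≢b , y'≢y = avoid₂ b y
    in twoCommonNeighbours⇒twoProperPaths G K×K-loopless c u≢v (≢-snd (≢-sym y'≢y))
         (≢-sym x≢a , ≢-sym y≢b) (x≢a' , y≢b) (≢-sym x≢a , ≢-sym y'≢b) (x≢a' , y'≢b)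

  K₃₊×K₃₊-connect : ∀ u v → u ≢ v → ProperGeodesic G c u v × TwoProperPaths G c u v
  K₃₊×K₃₊-connect u v u≢v with u ⌢? v | commonNeighbour u v
  ... | yes u⌢v | _ , u⌢w , w⌢v =
    edge⇒properGeodesic G K×K-loopless c u⌢v ,
    edgeAndCommonNeighbour⇒twoProperPaths G K×K-loopless c u⌢v u⌢w w⌢v
  ... | no u≁v  | _ , u⌢w , w⌢v =
    commonNeighbour⇒properGeodesic G K×K-loopless c u≢v u≁v u⌢w w⌢v ,
    nonadjacent⇒twoProperPaths u≢v u≁v

  K₃₊×K₃₊-strongProper : StrongProperConnecting G c
  K₃₊×K₃₊-strongProper u v u≢v = proj₁ (K₃₊×K₃₊-connect u v u≢v)

  K₃₊×K₃₊-proper2 : Proper2Connecting G c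
  K₃₊×K₃₊-proper2 u v u≢v = proj₂ (K₃₊×K₃₊-connect u v u≢v)

module _ {m : ℕ} where
  private
    G = K 2 ×ᵍ K (3 + m)
    _⌢_ = _~_ G

  side : V G → Fin 2
  side = proj₁

  everyWalk-sideProper : ∀ {u v} (p : Walk G u v) → VertexProper G side p
  everyWalk-sideProper = properColouring⇒vertexProper G side proj₁

  module _ {i j : Fin 2} (i≢j : i ≢ j) where
    private
      i⌢j : ∀ {b b'} → b ≢ b' → (i , b) ⌢ (j , b')
      i⌢j b≢b' = i≢j , b≢b'

      j⌢i : ∀ {b b'} → b ≢ b' → (j , b) ⌢ (i , b')
      j⌢i b≢b' = ≢-sym i≢j , b≢b'

      i≠j : ∀ {b b' : Fin (3 + m)} → (i , b) ≢ (j , b')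
      i≠j = ≢-fst i≢j

      j≠i : ∀ {b b' : Fin (3 + m)} → (j , b) ≢ (i , b')
      j≠i = ≢-fst (≢-sym i≢j)

    twins-far : ∀ b → Far G (i , b) (j , b)
    twins-far b = noCommonNeighbour⇒far G i≠j (λ (_ , b≢b) → b≢b refl)
      λ (x , _) (i≢x , _) (x≢j , _) → x≢j (Fin2-≢⇒≡ i≢j (≢-sym i≢x))

    sameSide-connect : ∀ {b b' c} → b ≢ b' → c ≢ b → c ≢ b' →
      ProperGeodesic G side (i , b) (i , b') × TwoProperPaths G side (i , b) (i , b')
    sameSide-connect {b} {b'} {c} b≢b' c≢b c≢b' =
      (p , (p-path , λ q _ → len≥2 G (≢-snd b≢b') (λ (i≢i , _) → i≢i refl) q) ,
           everyWalk-sideProper p) ,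
      p , q , p-path , q-path , (λ ()) ,
      All≢⇒disjoint G p q ((≢-snd c≢b' ∷ j≠i ∷ ≢-snd c≢b ∷ []) ∷ []) ,
      everyWalk-sideProper p , everyWalk-sideProper q
      where
      p q : Walk G (i , b) (i , b')
      p = (i , b) ∷⟨ i⌢j (≢-sym c≢b) ⟩ ((j , c) ∷⟨ j⌢i c≢b' ⟩ [ i , b' ])
      q = (i , b) ∷⟨ i⌢j b≢b' ⟩ ((j , b') ∷⟨ j⌢i (≢-sym c≢b') ⟩ ((i , c) ∷⟨ i⌢j c≢b ⟩
          ((j , b) ∷⟨ j⌢i b≢b' ⟩ [ i , b' ])))
      p-path : IsPath G p
      p-path = (i≠j ∷ ≢-snd b≢b' ∷ []) ∷ (j≠i ∷ []) ∷ [] ∷ []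
      q-path : IsPath G q
      q-path = (i≠j ∷ ≢-snd (≢-sym c≢b) ∷ i≠j ∷ ≢-snd b≢b' ∷ []) ∷
               (j≠i ∷ ≢-snd (≢-sym b≢b') ∷ j≠i ∷ []) ∷
               (i≠j ∷ ≢-snd c≢b' ∷ []) ∷
               (j≠i ∷ []) ∷ [] ∷ []

    oppositeSides-connect : ∀ {b b' c} → b ≢ b' → c ≢ b → c ≢ b' →
      ProperGeodesic G side (i , b) (j , b') × TwoProperPaths G side (i , b) (j , b')
    oppositeSides-connect {b} {b'} {c} b≢b' c≢b c≢b' =
      edge⇒properGeodesic G K×K-loopless side (i⌢j b≢b') ,
      p , q , (i≠j ∷ []) ∷ [] ∷ [] , q-path , (λ ()) , (λ _ ()) ,
      everyWalk-sideProper p , everyWalk-sideProper q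
      where
      p q : Walk G (i , b) (j , b')
      p = (i , b) ∷⟨ i⌢j b≢b' ⟩ [ j , b' ]
      -- for m = 3 no u-v path of length 3 exists, and paths here have odd length
      q = (i , b) ∷⟨ i⌢j (≢-sym c≢b) ⟩ ((j , c) ∷⟨ j⌢i c≢b' ⟩ ((i , b') ∷⟨ i⌢j (≢-sym b≢b') ⟩
          ((j , b) ∷⟨ j⌢i (≢-sym c≢b) ⟩ ((i , c) ∷⟨ i⌢j c≢b' ⟩ [ j , b' ]))))
      q-path : IsPath G q
      q-path = (i≠j ∷ ≢-snd b≢b' ∷ i≠j ∷ ≢-snd (≢-sym c≢b) ∷ i≠j ∷ []) ∷
               (j≠i ∷ ≢-snd c≢b ∷ j≠i ∷ ≢-snd c≢b' ∷ []) ∷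
               (i≠j ∷ ≢-snd (≢-sym c≢b') ∷ i≠j ∷ []) ∷
               (j≠i ∷ ≢-snd b≢b' ∷ []) ∷
               (i≠j ∷ []) ∷ [] ∷ []

    twins-connect : ∀ {b c d} → c ≢ b → d ≢ b → d ≢ c →
      ProperGeodesic G side (i , b) (j , b) × TwoProperPaths G side (i , b) (j , b)
    twins-connect {b} {c} {d} c≢b d≢b d≢c =
      (p , (p-path , λ q _ → twins-far b q) , everyWalk-sideProper p) ,
      p , q , p-path , q-path , (λ { refl → d≢c refl }) ,
      All≢⇒disjoint G p q ((≢-snd (≢-sym d≢c) ∷ j≠i ∷ []) ∷ (i≠j ∷ ≢-snd d≢c ∷ []) ∷ []) ,
      everyWalk-sideProper p , everyWalk-sideProper q
      where
      p q : Walk G (i , b) (j , b)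
      p = (i , b) ∷⟨ i⌢j (≢-sym c≢b) ⟩ ((j , c) ∷⟨ j⌢i (≢-sym d≢c) ⟩ ((i , d) ∷⟨ i⌢j d≢b ⟩ [ j , b ]))
      q = (i , b) ∷⟨ i⌢j (≢-sym d≢b) ⟩ ((j , d) ∷⟨ j⌢i d≢c ⟩ ((i , c) ∷⟨ i⌢j c≢b ⟩ [ j , b ]))
      p-path : IsPath G p
      p-path = (i≠j ∷ ≢-snd (≢-sym d≢b) ∷ i≠j ∷ []) ∷ (j≠i ∷ ≢-snd c≢b ∷ []) ∷ (i≠j ∷ []) ∷ [] ∷ []
      q-path : IsPath G q
      q-path = (i≠j ∷ ≢-snd (≢-sym c≢b) ∷ i≠j ∷ []) ∷ (j≠i ∷ ≢-snd d≢b ∷ []) ∷ (i≠j ∷ []) ∷ [] ∷ []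

  K₂×K₃₊-connect : ∀ u v → u ≢ v → ProperGeodesic G side u v × TwoProperPaths G side u v
  K₂×K₃₊-connect (i , b) (j , b') u≢v with i ≟ j
  ... | yes refl =
    let i' , i≢i' = another i
        c , c≢b , c≢b' = avoid₂ b b'
    in sameSide-connect i≢i' (u≢v ∘ cong (i ,_)) c≢b c≢b'
  ... | no i≢j with b ≟ b'
  ...   | yes refl =
    let c , c≢b , _ = avoid₂ b b
        d , d≢b , d≢c = avoid₂ b c
    in twins-connect i≢j c≢b d≢b d≢c
  ...   | no b≢b' =
    let c , c≢b , c≢b' = avoid₂ b b'
    in oppositeSides-connect i≢j b≢b' c≢b c≢b'

  K₂×K₃₊-strongProper : StrongProperConnecting G side
  K₂×K₃₊-strongProper u v u≢v = proj₁ (K₂×K₃₊-connect u v u≢v)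

  K₂×K₃₊-proper2 : Proper2Connecting G side
  K₂×K₃₊-proper2 u v u≢v = proj₂ (K₂×K₃₊-connect u v u≢v)

theorem6p4 : ∀ (n m : ℕ) → 3 ≤ n → 3 ≤ m →
    (SPVC≡ (K n ×ᵍ K m) 1 × PVC2≡ (K n ×ᵍ K m) 1)
    × (SPVC≡ (K 2 ×ᵍ K m) 2 × PVC2≡ (K 2 ×ᵍ K m) 2)
theorem6p4 _ _ (s≤s (s≤s (s≤s _))) (s≤s (s≤s (s≤s _))) =
  ( spvc≡1 _ (zero , zero) incomplete (monochrome , K₃₊×K₃₊-strongProper monochrome)
  , pvc₂≡1 _ (monochrome , K₃₊×K₃₊-proper2 monochrome) )
  , ( spvc≡2 _ far incomplete (side , K₂×K₃₊-strongProper)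
    , pvc₂≡2 _ far (side , K₂×K₃₊-proper2) )
  where
  monochrome : ∀ {A : Set} → A → Fin 1
  monochrome _ = zero
  incomplete : ∀ {n m} → ¬ IsComplete (K (suc n) ×ᵍ K (3 + m))
  incomplete = K×K-incomplete zero zero (suc zero) (λ ())
  far : ∀ {m} → Far (K 2 ×ᵍ K (3 + m)) (zero , zero) (suc zero , zero)
  far = twins-far {i = zero} {j = suc zero} (λ ()) zero
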